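{- Let $G$ be an interval graph with a fixed interval representation, and consider an instance of \textsc{Requirement Induced Disjoint Paths} on $G$ with terminal pairs $(s_1,t_1),\ldots,(s_k,t_k)$ and requirements $r_1,\ldots,r_k$. Let $P_1,\ldots,P_\ell$ form a solution. Then: (i) for $1\le i\le k$, any interval $I_{P_a}$ with color $i$ intersects the intervals of the vertices representing $s_i$ and $t_i$ and does not intersect any other terminal interval; (ii) for $1\le a<b\le \ell$ such that $I_{P_a}$ and $I_{P_b}$ are defined, $I_{P_a}\cap I_{P_b}=\emptyset$; (iii) for $1\le i<j\le k$, there is no interval with color $j$ that lies between two intervals with color $i$, and no interval with color $i$ that lies between two intervals with color $j$.
   Context: All graphs are finite, simple and undirected. An interval graph $G$ with $n$ vertices has an interval representation assigning each vertex $u$ a closed interval $[l_u,r_u]$ of the line, where all endpoints are distinct integers in $\{1,\ldots,2n\}$, such that two vertices are adjacent iff their intervals intersect; vertices are identified with their intervals. For a path $P=v_1\cdots v_r$, the vertices $v_1,v_r$ are its ends and $v_2,\ldots,v_{r-1}$ its inner vertices; an edge $v_iv_j$ with $i+1<j$ is an inner chord of $P$ if $v_i$ or $v_j$ is an inner vertex. Distinct paths $P_1,\ldots,P_\ell$ are mutually induced if: (i) no $P_i$ has an inner chord; (ii) any two distinct $P_i,P_j$ share only vertices that are ends of both; (iii) no inner vertex $u$ of any $P_i$ is adjacent to a vertex $v$ of some $P_j$, $j\neq i$, except when $v$ is an end of both $P_i$ and $P_j$. \textsc{Requirement Induced Disjoint Paths}: input a graph $G$, pairs $(s_1,t_1),\ldots,(s_k,t_k)$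 of vertices with $s_i\neq t_i$ and $\{s_i,t_i\}\neq\{s_j,t_j\}$ for $i<j$ (a vertex may occur in several pairs), and positive integers $r_1,\ldots,r_k$; a solution is a family of $\ell=r_1+\cdots+r_k$ mutually induced paths $P_1,\ldots,P_\ell$ of which exactly $r_i$ have ends $s_i$ and $t_i$, for each $i$. A vertex is a terminal vertex (its interval a terminal interval) if it equals some $s_i$ or $t_i$; it represents the terminals placed on it. For a path $P$ with ends $s_i,t_i$ that has at least one inner vertex, $I_P$ denotes the union of the intervals of the inner vertices of $P$ (an interval of the line), and $I_P$ is said to have color $i$. An interval $[c,d]$ lies between intervals $[a_1,b_1]$ and $[a_2,b_2]$ if $b_1\le c$ and $d\le a_2$. -}

module Defs where

open import Data.Nat using (ℕ; zero; suc; _+_; _≤_; _<_; _⊔_; _⊓_; _*_)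
open import Data.Fin using (Fin; zero; suc; inject₁; fromℕ)
open import Data.Fin.Properties using (_≟_)
open import Data.Sum using (_⊎_; inj₁; inj₂)
open import Data.Product using (_×_; _,_; Σ; ∃; ∃-syntax)
open import Data.List using (List; length; filter; reverse)
open import Data.List.Base using (allFin)
open import Data.Vec.Functional using (toList)
open import Relation.Binary.PropositionalEquality using (_≡_; _≢_)
open import Relation.Nullary using (¬_; Dec)
open import Relation.Nullary.Decidable using (_×-dec_; _⊎-dec_)
open import Function.Definitions using (Injective)

-- Interval representation of a graph on the vertex set Fin n.
-- Vertex u is the closed interval [ l u , r u ]; all 2n endpoints are
-- distinct integers in {1,…,2n}.

endpoint : ∀ {n} → (Fin n → ℕ) → (Fin n → ℕ) → Fin n ⊎ Fin n → ℕ
endpoint l r (inj₁ u) = l u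
endpoint l r (inj₂ u) = r u

record IntervalRep (n : ℕ) : Set where
  field
    l r        : Fin n → ℕ
    l≥1        : ∀ u → 1 ≤ l u
    l<r        : ∀ u → l u < r u
    r≤2n       : ∀ u → r u ≤ 2 * n
    distinct   : Injective _≡_ _≡_ (endpoint l r)

Meet : ℕ × ℕ → ℕ × ℕ → Set
Meet (a , b) (c , d) = a ≤ d × c ≤ b

Between : ℕ × ℕ → ℕ × ℕ → ℕ × ℕ → Set
Between (c , d) (a₁ , b₁) (a₂ , b₂) = b₁ ≤ c × d ≤ a₂

module _ {n : ℕ} (R : IntervalRep n) where
  open IntervalRep R

  ival : Fin n → ℕ × ℕ
  ival u = (l u , r u)

  Adj : Fin n → Fin n → Set
  Adj u v = u ≢ v × Meet (ival u) (ival v)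

-- Paths v₁ ⋯ v_{m+2} (at least two vertices; m = number of inner vertices)

record Path (n : ℕ) : Set where
  field
    m : ℕ
    v : Fin (suc (suc m)) → Fin n

module _ {n : ℕ} where
  open Path

  first last : Path n → Fin n
  first P = v P zero
  last  P = v P (fromℕ (suc (m P)))

  inner : (P : Path n) → Fin (m P) → Fin n
  inner P j = v P (suc (inject₁ j))

  verts : Path n → List (Fin n)
  verts P = toList (v P)

  IsInnerIndex : (P : Path n) → Fin (suc (suc (m P))) → Set
  IsInnerIndex P i = ∃[ j ] i ≡ suc (inject₁ j)

  OnPath : Fin n → Path n → Set
  OnPath u P = ∃[ i ] v P i ≡ u

  IsInner : Fin n → Path n → Set
  IsInner u P = ∃[ j ] inner P j ≡ u

  IsEnd : Fin n → Path n → Set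
  IsEnd u P = (u ≡ first P) ⊎ (u ≡ last P)

  HasEnds : Path n → Fin n → Fin n → Set
  HasEnds P x y = (first P ≡ x × last P ≡ y) ⊎ (first P ≡ y × last P ≡ x)

  hasEnds? : ∀ P x y → Dec (HasEnds P x y)
  hasEnds? P x y = ((first P ≟ x) ×-dec (last P ≟ y)) ⊎-dec ((first P ≟ y) ×-dec (last P ≟ x))

  -- same path (as a subgraph): same vertex sequence up to reversal
  SamePath : Path n → Path n → Set
  SamePath P Q = verts P ≡ verts Q ⊎ verts P ≡ reverse (verts Q)

module _ {n : ℕ} (R : IntervalRep n) where
  open Path

  IsPath : Path n → Set
  IsPath P = Injective _≡_ _≡_ (v P)
           × (∀ (i : Fin (suc (m P))) → Adj R (v P (inject₁ i)) (v P (suc i)))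

  HasInnerChord : Path n → Set
  HasInnerChord P = Σ (Fin (suc (suc (m P)))) λ i → Σ (Fin (suc (suc (m P)))) λ j →
      suc (Data.Fin.toℕ i) < Data.Fin.toℕ j
    × Adj R (v P i) (v P j)
    × (IsInnerIndex P i ⊎ IsInnerIndex P j)

  MutuallyInduced : ∀ {ℓ} → (Fin ℓ → Path n) → Set
  MutuallyInduced {ℓ} P =
      (∀ a → IsPath (P a))
    × (∀ a b → a ≢ b → ¬ SamePath (P a) (P b))
    × (∀ a → ¬ HasInnerChord (P a))
    × (∀ a b → a ≢ b → ∀ u → OnPath u (P a) → OnPath u (P b) → IsEnd u (P a) × IsEnd u (P b))
    × (∀ a b → a ≢ b → ∀ u w → IsInner u (P a) → OnPath w (P b) → Adj R u w
         → IsEnd w (P a) × IsEnd w (P b))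

sumFin : ∀ k → (Fin k → ℕ) → ℕ
sumFin zero    f = 0
sumFin (suc k) f = f zero + sumFin k (λ i → f (suc i))

record Instance (n : ℕ) : Set where
  field
    k        : ℕ
    s t      : Fin k → Fin n
    s≢t      : ∀ i → s i ≢ t i
    pairs≢   : ∀ i j → i ≢ j → ¬ ((s i ≡ s j × t i ≡ t j) ⊎ (s i ≡ t j × t i ≡ s j))
    req      : Fin k → ℕ
    req>0    : ∀ i → 0 < req i

module _ {n : ℕ} (R : IntervalRep n) (I : Instance n) where
  open Instance I

  IsSolution : ∀ {ℓ} → (Fin ℓ → Path n) → Set
  IsSolution {ℓ} P =
      ℓ ≡ sumFin k req
    × MutuallyInduced R P
    × (∀ i → length (filter (λ a → hasEnds? (P a) (s i) (t i)) (allFin ℓ)) ≡ req i)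

IsTerminal : ∀ {n} → Instance n → Fin n → Set
IsTerminal I u = ∃[ j ] (u ≡ Instance.s I j ⊎ u ≡ Instance.t I j)

-- I_P : the union of the inner intervals of P (defined when P has an
-- inner vertex).  Since consecutive inner intervals intersect, this union
-- is the interval [min of left endpoints , max of right endpoints].

minFin : ∀ k → (Fin (suc k) → ℕ) → ℕ
minFin zero    f = f zero
minFin (suc k) f = f zero ⊓ minFin k (λ i → f (suc i))

maxFin : ∀ k → (Fin (suc k) → ℕ) → ℕ
maxFin zero    f = f zero
maxFin (suc k) f = f zero ⊔ maxFin k (λ i → f (suc i))

HasInnerVertex : ∀ {n} → Path n → Set
HasInnerVertex P = 0 < Path.m P

module _ {n : ℕ} (R : IntervalRep n) where
  open IntervalRep R

  IP : (P : Path n) → HasInnerVertex P → ℕ × ℕ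
  IP record { m = suc m ; v = v } _ =
      ( minFin m (λ j → l (v (suc (inject₁ j))))
      , maxFin m (λ j → r (v (suc (inject₁ j)))) )

-- Every inner interval of a path of a solution touches only the two ends of
-- that path among the vertices of the other paths, so the hull I_P of its
-- inner intervals can meet neither the inner intervals of another path nor a
-- terminal that is not an end of P (every terminal is the end of some path,
-- since all requirements are positive).  Conversely I_P meets the intervals of
-- both ends of P.  If an interval of colour j lay between two of colour i, it
-- would meet both s_i and t_i, forcing {s_i,t_i} = {s_j,t_j}.
module Submission where

open import Defs
open import Data.Nat using (ℕ)
open import Data.Fin using (Fin; _<_)
open import Data.Product using (_×_; Σ)
open import Relation.Binary.PropositionalEquality using (_≡_; _≢_)
open import Relation.Nullary using (¬_)

open import Data.Nat using (zero; suc; _⊓_; _⊔_; _≤?_) renaming (_≤_ to _≤ℕ_; _<_ to _<ℕ_)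
open import Data.Nat.Properties
  using (≤-refl; ≤-trans; <⇒≤; ≰⇒>; ≮⇒≥; <⇒≱; m⊓n≤m; m⊓n≤n; m≤m⊔n; m≤n⊔m; ⊓-pres-m<; ⊔-pres-<m)
open import Data.Fin using (zero; suc; inject₁; fromℕ)
open import Data.Fin.Properties using (_≟_; suc-injective; fromℕ≢inject₁) renaming (<⇒≢ to <⇒≢ᶠ)
open import Data.Product using (_,_; proj₁; proj₂; ∃-syntax)
open import Data.Sum using (_⊎_; inj₁; inj₂)
open import Data.Empty using (⊥; ⊥-elim)
open import Data.List using (_∷_; length; filter; allFin)
open import Data.List.Membership.Propositional using (_∈_)
open import Data.List.Membership.Propositional.Properties using (∈-filter⁻)
open import Data.List.Relation.Unary.Any using (here)
open import Function using (_∘_)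
open import Relation.Unary using (Pred; Decidable)
open import Relation.Nullary using (yes; no)
open import Relation.Binary.PropositionalEquality using (refl; sym; trans; subst; ≢-sym)

m⊓n≤o⇒n≤o : ∀ {m n o} → m ⊓ n ≤ℕ o → o <ℕ m → n ≤ℕ o
m⊓n≤o⇒n≤o m⊓n≤o o<m = ≮⇒≥ λ o<n → <⇒≱ (⊓-pres-m< o<m o<n) m⊓n≤o

o≤m⊔n⇒o≤n : ∀ {m n o} → o ≤ℕ m ⊔ n → m <ℕ o → o ≤ℕ n
o≤m⊔n⇒o≤n o≤m⊔n m<o = ≮⇒≥ λ n<o → <⇒≱ (⊔-pres-<m m<o n<o) o≤m⊔n

minFin≤ : ∀ k (f : Fin (suc k) → ℕ) j → minFin k f ≤ℕ f j
minFin≤ zero    f zero    = ≤-refl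
minFin≤ (suc k) f zero    = m⊓n≤m _ _
minFin≤ (suc k) f (suc j) = ≤-trans (m⊓n≤n (f zero) _) (minFin≤ k (f ∘ suc) j)

≤maxFin : ∀ k (f : Fin (suc k) → ℕ) j → f j ≤ℕ maxFin k f
≤maxFin zero    f zero    = ≤-refl
≤maxFin (suc k) f zero    = m≤m⊔n _ _
≤maxFin (suc k) f (suc j) = ≤-trans (≤maxFin k (f ∘ suc) j) (m≤n⊔m (f zero) _)

Meet-sym : ∀ X Y → Meet X Y → Meet Y X
Meet-sym _ _ (p , q) = q , p

Between-Meet : ∀ {A B C X} → proj₁ C ≤ℕ proj₂ C → Between C A B → Meet A X → Meet B X → Meet C X
Between-Meet c≤d (b₁≤c , d≤a₂) (_ , x≤b₁) (a₂≤y , _) =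
  ≤-trans c≤d (≤-trans d≤a₂ a₂≤y) , ≤-trans x≤b₁ (≤-trans b₁≤c c≤d)

filter-nonempty⇒∃ : ∀ {a p} {A : Set a} {Q : Pred A p} (Q? : Decidable Q) xs
  → 0 <ℕ length (filter Q? xs) → ∃[ x ] Q x
filter-nonempty⇒∃ Q? xs nonempty with filter Q? xs in eq | nonempty
... | x ∷ _ | _ = x , proj₂ (∈-filter⁻ Q? {xs = xs} (subst (x ∈_) (sym eq) (here refl)))

hull : ∀ k → (Fin (suc k) → ℕ × ℕ) → ℕ × ℕ
hull k I = minFin k (proj₁ ∘ I) , maxFin k (proj₂ ∘ I)

Linked : ∀ k → (Fin (suc k) → ℕ × ℕ) → Set
Linked k I = ∀ (j : Fin k) → Meet (I (inject₁ j)) (I (suc j))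

hull-ordered : ∀ k (I : Fin (suc k) → ℕ × ℕ) → proj₁ (I zero) ≤ℕ proj₂ (I zero)
  → proj₁ (hull k I) ≤ℕ proj₂ (hull k I)
hull-ordered k I ordered =
  ≤-trans (minFin≤ k (proj₁ ∘ I) zero) (≤-trans ordered (≤maxFin k (proj₂ ∘ I) zero))

Meet-hull⁺ : ∀ k (I : Fin (suc k) → ℕ × ℕ) j X → Meet (I j) X → Meet (hull k I) X
Meet-hull⁺ k I j X (a≤d , c≤b) =
  ≤-trans (minFin≤ k (proj₁ ∘ I) j) a≤d , ≤-trans c≤b (≤maxFin k (proj₂ ∘ I) j)

-- A linked family covers its hull: an interval meeting the hull but missing
-- I zero lies on one side of I zero, hence still meets the hull of the
-- remaining members, which overlaps I zero.
Meet-hull⁻ : ∀ k (I : Fin (suc k) → ℕ × ℕ) → Linked k I → ∀ {c d} → c ≤ℕ d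
  → Meet (hull k I) (c , d) → ∃[ j ] Meet (I j) (c , d)
Meet-hull⁻ zero    I linked c≤d meets = zero , meets
Meet-hull⁻ (suc k) I linked {c} {d} c≤d (min≤d , c≤max)
  with proj₁ (I zero) ≤? d | c ≤? proj₂ (I zero)
... | yes a₀≤d | yes c≤b₀ = zero , a₀≤d , c≤b₀
... | no a₀≰d  | _        =
  let j , meets = Meet-hull⁻ k (I ∘ suc) (linked ∘ suc) c≤d
                (m⊓n≤o⇒n≤o min≤d (≰⇒> a₀≰d) ,
                 ≤-trans c≤d (≤-trans (<⇒≤ (≰⇒> a₀≰d))
                   (≤-trans (proj₁ (linked zero)) (≤maxFin k (proj₂ ∘ I ∘ suc) zero))))
  in suc j , meets
... | yes _    | no c≰b₀  =
  let j , meets = Meet-hull⁻ k (I ∘ suc) (linked ∘ suc) c≤d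
                (≤-trans (minFin≤ k (proj₁ ∘ I ∘ suc) zero)
                   (≤-trans (proj₂ (linked zero)) (≤-trans (<⇒≤ (≰⇒> c≰b₀)) c≤d)) ,
                 o≤m⊔n⇒o≤n c≤max (≰⇒> c≰b₀))
  in suc j , meets

module _ {n : ℕ} where

  HasEnds⇒IsEnd : ∀ (P : Path n) {x y} → HasEnds P x y → IsEnd x P × IsEnd y P
  HasEnds⇒IsEnd P (inj₁ (first≡x , last≡y)) = inj₁ (sym first≡x) , inj₂ (sym last≡y)
  HasEnds⇒IsEnd P (inj₂ (first≡y , last≡x)) = inj₂ (sym last≡x) , inj₁ (sym first≡y)

  HasEnds⇒IsEnd⁻ : ∀ (P : Path n) {x y z} → HasEnds P x y → IsEnd z P → z ≡ x ⊎ z ≡ y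
  HasEnds⇒IsEnd⁻ P (inj₁ (e₁ , _)) (inj₁ e) = inj₁ (trans e e₁)
  HasEnds⇒IsEnd⁻ P (inj₁ (_ , e₂)) (inj₂ e) = inj₂ (trans e e₂)
  HasEnds⇒IsEnd⁻ P (inj₂ (e₁ , _)) (inj₁ e) = inj₂ (trans e e₁)
  HasEnds⇒IsEnd⁻ P (inj₂ (_ , e₂)) (inj₂ e) = inj₁ (trans e e₂)

  IsEnd⇒OnPath : ∀ (P : Path n) {z} → IsEnd z P → OnPath z P
  IsEnd⇒OnPath P (inj₁ e) = zero , sym e
  IsEnd⇒OnPath P (inj₂ e) = fromℕ (suc (Path.m P)) , sym e

  IsInner⇒OnPath : ∀ (P : Path n) {u} → IsInner u P → OnPath u P
  IsInner⇒OnPath P (j , refl) = suc (inject₁ j) , refl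

module _ {n : ℕ} (R : IntervalRep n) where
  open IntervalRep R using (l<r)

  ival-ordered : ∀ u → proj₁ (ival R u) ≤ℕ proj₂ (ival R u)
  ival-ordered u = <⇒≤ (l<r u)

  IsInner⇒¬IsEnd : ∀ (P : Path n) → IsPath R P → ∀ {u} → IsInner u P → ¬ IsEnd u P
  IsInner⇒¬IsEnd P (injective , _) (j , refl) (inj₁ e) with injective e
  ... | ()
  IsInner⇒¬IsEnd P (injective , _) (j , refl) (inj₂ e) =
    fromℕ≢inject₁ (sym (suc-injective (injective e)))

  IP-ordered : ∀ (P : Path n) h → proj₁ (IP R P h) ≤ℕ proj₂ (IP R P h)
  IP-ordered record { m = suc m ; v = v } _ =
    hull-ordered m (ival R ∘ v ∘ suc ∘ inject₁) (ival-ordered (v (suc zero)))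

  Meet-IP⁺ : ∀ (P : Path n) h {u} → IsInner u P → ∀ X → Meet (ival R u) X → Meet (IP R P h) X
  Meet-IP⁺ record { m = suc m ; v = v } _ (j , refl) =
    Meet-hull⁺ m (ival R ∘ v ∘ suc ∘ inject₁) j

  Meet-IP⁻ : ∀ (P : Path n) h → IsPath R P → ∀ {c d} → c ≤ℕ d
    → Meet (IP R P h) (c , d) → ∃[ u ] IsInner u P × Meet (ival R u) (c , d)
  Meet-IP⁻ record { m = suc m ; v = v } _ (_ , adjacent) c≤d meets =
    let j , meets-j = Meet-hull⁻ m (ival R ∘ v ∘ suc ∘ inject₁)
                        (λ j → proj₂ (adjacent (suc (inject₁ j)))) c≤d meets
    in _ , (j , refl) , meets-j

  Meet-IP-ends : ∀ (P : Path n) h → IsPath R P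
    → Meet (IP R P h) (ival R (first P)) × Meet (IP R P h) (ival R (last P))
  Meet-IP-ends P@(record { m = suc m ; v = v }) h (_ , adjacent) =
    Meet-IP⁺ P h (zero , refl) _ (Meet-sym _ _ (proj₂ (adjacent zero))) ,
    Meet-IP⁺ P h (fromℕ m , refl) _ (proj₂ (adjacent (fromℕ (suc m))))

  Meet-IP-HasEnds : ∀ (P : Path n) h → IsPath R P → ∀ {x y} → HasEnds P x y
    → Meet (IP R P h) (ival R x) × Meet (IP R P h) (ival R y)
  Meet-IP-HasEnds P h path (inj₁ (refl , refl)) = Meet-IP-ends P h path
  Meet-IP-HasEnds P h path (inj₂ (refl , refl)) =
    let first , last = Meet-IP-ends P h path in last , first

module Induced {n ℓ : ℕ} (R : IntervalRep n) (P : Fin ℓ → Path n)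
                (induced : MutuallyInduced R P) where

  private
    isPath = proj₁ induced
    shared = proj₁ (proj₂ (proj₂ (proj₂ induced)))
    adjacent = proj₂ (proj₂ (proj₂ (proj₂ induced)))

  -- Shared vertices are ends of both paths, so the inner u is not w and (iii) applies.
  inner-touch-other⇒IsEnd : ∀ {a b} → a ≢ b → ∀ {u w} → IsInner u (P a) → OnPath w (P b)
    → Meet (ival R u) (ival R w) → IsEnd w (P a) × IsEnd w (P b)
  inner-touch-other⇒IsEnd {a} {b} a≢b {u} {w} u-inner w-on touch with u ≟ w
  ... | yes refl = ⊥-elim (IsInner⇒¬IsEnd R (P a) (isPath a) u-inner
                     (proj₁ (shared a b a≢b u (IsInner⇒OnPath (P a) u-inner) w-on)))
  ... | no u≢w   = adjacent a b a≢b u w u-inner w-on (u≢w , touch)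

  inner-touch-end⇒IsEnd : ∀ {a b u w} → IsInner u (P a) → IsEnd w (P b)
    → Meet (ival R u) (ival R w) → IsEnd w (P a)
  inner-touch-end⇒IsEnd {a} {b} u-inner w-end touch with a ≟ b
  ... | yes refl = w-end
  ... | no a≢b   = proj₁ (inner-touch-other⇒IsEnd a≢b u-inner (IsEnd⇒OnPath (P b) w-end) touch)

  IP-disjoint : ∀ {a b} → a ≢ b → ∀ ha hb → ¬ Meet (IP R (P a) ha) (IP R (P b) hb)
  IP-disjoint {a} {b} a≢b ha hb meets =
    let u , u-inner , u-meets = Meet-IP⁻ R (P a) ha (isPath a) (IP-ordered R (P b) hb) meets
        w , w-inner , w-meets = Meet-IP⁻ R (P b) hb (isPath b) (ival-ordered R u)
                                  (Meet-sym _ _ u-meets)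
    in IsInner⇒¬IsEnd R (P b) (isPath b) w-inner
         (proj₂ (inner-touch-other⇒IsEnd a≢b u-inner (IsInner⇒OnPath (P b) w-inner)
                   (Meet-sym _ _ w-meets)))

module Solution {n : ℕ} (R : IntervalRep n) (I : Instance n) {ℓ : ℕ} (P : Fin ℓ → Path n)
                (solution : IsSolution R I P) where
  open Instance I
  open Induced R P (proj₁ (proj₂ solution)) public

  private
    isPath = proj₁ (proj₁ (proj₂ solution))

  path-with-ends : ∀ i → ∃[ a ] HasEnds (P a) (s i) (t i)
  path-with-ends i = filter-nonempty⇒∃ (λ a → hasEnds? (P a) (s i) (t i)) (allFin ℓ)
    (subst (0 <ℕ_) (sym (proj₂ (proj₂ solution) i)) (req>0 i))

  terminal-IsEnd : ∀ {w} → IsTerminal I w → ∃[ b ] IsEnd w (P b)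
  terminal-IsEnd (i , w≡) with path-with-ends i
  ... | b , ends with w≡
  ...   | inj₁ refl = b , proj₁ (HasEnds⇒IsEnd (P b) ends)
  ...   | inj₂ refl = b , proj₂ (HasEnds⇒IsEnd (P b) ends)

  IP-meets-ends : ∀ {i a} h → HasEnds (P a) (s i) (t i)
    → Meet (IP R (P a) h) (ival R (s i)) × Meet (IP R (P a) h) (ival R (t i))
  IP-meets-ends {a = a} h = Meet-IP-HasEnds R (P a) h (isPath a)

  IP-meets-terminal : ∀ {i a} h → HasEnds (P a) (s i) (t i) → ∀ {w} → IsTerminal I w
    → Meet (IP R (P a) h) (ival R w) → w ≡ s i ⊎ w ≡ t i
  IP-meets-terminal {a = a} h ends terminal meets =
    let u , u-inner , u-meets = Meet-IP⁻ R (P a) h (isPath a) (ival-ordered R _) meets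
        b , w-end = terminal-IsEnd terminal
    in HasEnds⇒IsEnd⁻ (P a) ends (inner-touch-end⇒IsEnd u-inner w-end u-meets)

  IP-avoids-terminals : ∀ {i a} h → HasEnds (P a) (s i) (t i) → ∀ w → IsTerminal I w
    → w ≢ s i → w ≢ t i → ¬ Meet (IP R (P a) h) (ival R w)
  IP-avoids-terminals h ends w terminal w≢s w≢t meets
    with IP-meets-terminal h ends terminal meets
  ... | inj₁ w≡s = w≢s w≡s
  ... | inj₂ w≡t = w≢t w≡t

  no-colour-between : ∀ {i j} → i ≢ j → ∀ a b c ha hb hc
    → HasEnds (P a) (s i) (t i) → HasEnds (P b) (s i) (t i) → HasEnds (P c) (s j) (t j)
    → ¬ Between (IP R (P c) hc) (IP R (P a) ha) (IP R (P b) hb)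
  no-colour-between {i} {j} i≢j a b c ha hb hc ends-a ends-b ends-c between =
    same-pair (meets-IP-c (proj₁ meets-a) (proj₁ meets-b) (i , inj₁ refl))
              (meets-IP-c (proj₂ meets-a) (proj₂ meets-b) (i , inj₂ refl))
    where
    meets-a = IP-meets-ends ha ends-a
    meets-b = IP-meets-ends hb ends-b

    meets-IP-c : ∀ {w} → Meet (IP R (P a) ha) (ival R w) → Meet (IP R (P b) hb) (ival R w)
      → IsTerminal I w → w ≡ s j ⊎ w ≡ t j
    meets-IP-c ma mb terminal =
      IP-meets-terminal hc ends-c terminal (Between-Meet (IP-ordered R (P c) hc) between ma mb)

    same-pair : s i ≡ s j ⊎ s i ≡ t j → t i ≡ s j ⊎ t i ≡ t j → ⊥
    same-pair (inj₁ e₁) (inj₁ e₂) = s≢t i (trans e₁ (sym e₂))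
    same-pair (inj₁ e₁) (inj₂ e₂) = pairs≢ i j i≢j (inj₁ (e₁ , e₂))
    same-pair (inj₂ e₁) (inj₁ e₂) = pairs≢ i j i≢j (inj₂ (e₁ , e₂))
    same-pair (inj₂ e₁) (inj₂ e₂) = s≢t i (trans e₁ (sym e₂))

lemma1 : ∀ {n : ℕ} (R : IntervalRep n) (I : Instance n) {ℓ : ℕ} (P : Fin ℓ → Path n)
    → IsSolution R I P
    → (∀ (i : Fin (Instance.k I)) (a : Fin ℓ) (h : HasInnerVertex (P a))
         → HasEnds (P a) (Instance.s I i) (Instance.t I i)
         → Meet (IP R (P a) h) (ival R (Instance.s I i))
         × Meet (IP R (P a) h) (ival R (Instance.t I i))
         × (∀ w → IsTerminal I w → w ≢ Instance.s I i → w ≢ Instance.t I i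
              → ¬ Meet (IP R (P a) h) (ival R w)))
    × (∀ (a b : Fin ℓ) → a < b → (ha : HasInnerVertex (P a)) (hb : HasInnerVertex (P b))
         → ¬ Meet (IP R (P a) ha) (IP R (P b) hb))
    × (∀ (i j : Fin (Instance.k I)) → i < j
         → (∀ (a b c : Fin ℓ) (ha : HasInnerVertex (P a)) (hb : HasInnerVertex (P b))
              (hc : HasInnerVertex (P c))
              → HasEnds (P a) (Instance.s I i) (Instance.t I i)
              → HasEnds (P b) (Instance.s I i) (Instance.t I i)
              → HasEnds (P c) (Instance.s I j) (Instance.t I j)
              → ¬ Between (IP R (P c) hc) (IP R (P a) ha) (IP R (P b) hb))
         × (∀ (a b c : Fin ℓ) (ha : HasInnerVertex (P a)) (hb : HasInnerVertex (P b))
              (hc : HasInnerVertex (P c))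
              → HasEnds (P a) (Instance.s I j) (Instance.t I j)
              → HasEnds (P b) (Instance.s I j) (Instance.t I j)
              → HasEnds (P c) (Instance.s I i) (Instance.t I i)
              → ¬ Between (IP R (P c) hc) (IP R (P a) ha) (IP R (P b) hb)))
lemma1 R I P solution =
  (λ i a h ends → let ms , mt = IP-meets-ends h ends in ms , mt , IP-avoids-terminals h ends) ,
  (λ a b a<b → IP-disjoint (<⇒≢ᶠ a<b)) ,
  (λ i j i<j → no-colour-between (<⇒≢ᶠ i<j) , no-colour-between (≢-sym (<⇒≢ᶠ i<j)))
  where
  open Solution R I P solution
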